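{- Let $r\ge 3$ and let $G$ be a connected $\{Z_1,K_{1,r}\}$-free graph with a vertex of degree at least $r$. Then $G$ is isomorphic to a complete multipartite graph $K_{t_1,t_2,\dots,t_k}$ with $1\le t_i\le r-1$ for each $i$.
   Context: All graphs are finite and simple. $K_{1,r}$ is the star with $r$ leaves. $Z_1$ is the graph obtained from $K_{1,3}$ by adding one edge between two of its leaves. A graph is $\{Z_1,K_{1,r}\}$-free if it has no induced subgraph isomorphic to $Z_1$ or $K_{1,r}$. -}

module Defs where

open import Data.Nat using (ℕ; zero; suc; _+_)
open import Data.Fin using (Fin; zero; suc; _≟_)
open import Data.Bool using (Bool; true; false; not; if_then_else_)
open import Data.List using (map; allFin)
open import Data.Nat.ListAction using (sum)
open import Data.Product using (Σ; _,_; proj₁; ∃; _×_)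
open import Data.Empty using (⊥-elim)
open import Relation.Nullary using (¬_; yes; no)
open import Relation.Nullary.Decidable using (⌊_⌋)
open import Relation.Binary.PropositionalEquality using (_≡_; refl; sym; trans; cong)
open import Function.Bundles using (_⤖_; Bijection)
open import Function.Definitions using (Injective)

record Graph (V : Set) : Set where
  field
    adj    : V → V → Bool
    adj-sym    : ∀ x y → adj x y ≡ adj y x
    adj-irrefl : ∀ x → adj x x ≡ false
open Graph public

FinGraph : ℕ → Set
FinGraph n = Graph (Fin n)

deg : ∀ {n} → FinGraph n → Fin n → ℕ
deg G v = sum (map (λ u → if adj G v u then 1 else 0) (allFin _))

data Walk {V : Set} (G : Graph V) : V → V → Set where
  here : ∀ {x} → Walk G x x
  step : ∀ {x y z} → adj G x y ≡ true → Walk G y z → Walk G x z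

Connected : ∀ {V} → Graph V → Set
Connected {V} G = ∀ (x y : V) → Walk G x y

_≅_ : ∀ {V W} → Graph V → Graph W → Set
_≅_ {V} {W} G H = Σ (V ⤖ W) λ φ →
  ∀ x y → adj H (Bijection.to φ x) (Bijection.to φ y) ≡ adj G x y

HasInduced : ∀ {V W} → Graph V → Graph W → Set
HasInduced {V} {W} G H = Σ (W → V) λ f →
  Injective _≡_ _≡_ f × (∀ x y → adj G (f x) (f y) ≡ adj H x y)

Free : ∀ {V W} → Graph V → Graph W → Set
Free G H = ¬ HasInduced G H

starAdj : ∀ r → Fin (suc r) → Fin (suc r) → Bool
starAdj r zero    zero    = false
starAdj r zero    (suc _) = true
starAdj r (suc _) zero    = true
starAdj r (suc _) (suc _) = false

K1 : (r : ℕ) → FinGraph (suc r)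
K1 r = record { adj = starAdj r ; adj-sym = s ; adj-irrefl = i }
  where
  s : ∀ x y → starAdj r x y ≡ starAdj r y x
  s zero zero = refl
  s zero (suc _) = refl
  s (suc _) zero = refl
  s (suc _) (suc _) = refl
  i : ∀ x → starAdj r x x ≡ false
  i zero = refl
  i (suc _) = refl

-- Z1: K_{1,3} (centre 0, leaves 1,2,3) plus the edge 1–2.
z1Adj : Fin 4 → Fin 4 → Bool
z1Adj zero zero = false
z1Adj zero (suc _) = true
z1Adj (suc _) zero = true
z1Adj (suc zero) (suc (suc zero)) = true
z1Adj (suc (suc zero)) (suc zero) = true
z1Adj (suc _) (suc _) = false

Z1 : FinGraph 4
Z1 = record { adj = z1Adj ; adj-sym = s ; adj-irrefl = i }
  where
  s : ∀ x y → z1Adj x y ≡ z1Adj y x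
  s zero zero = refl
  s zero (suc _) = refl
  s (suc _) zero = refl
  s (suc zero) (suc zero) = refl
  s (suc zero) (suc (suc zero)) = refl
  s (suc zero) (suc (suc (suc zero))) = refl
  s (suc (suc zero)) (suc zero) = refl
  s (suc (suc zero)) (suc (suc zero)) = refl
  s (suc (suc zero)) (suc (suc (suc zero))) = refl
  s (suc (suc (suc zero))) (suc zero) = refl
  s (suc (suc (suc zero))) (suc (suc zero)) = refl
  s (suc (suc (suc zero))) (suc (suc (suc zero))) = refl
  i : ∀ x → z1Adj x x ≡ false
  i zero = refl
  i (suc zero) = refl
  i (suc (suc zero)) = refl
  i (suc (suc (suc zero))) = refl

cmpAdj : ∀ {k} (t : Fin k → ℕ) → Σ (Fin k) (λ i → Fin (t i)) → Σ (Fin k) (λ i → Fin (t i)) → Bool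
cmpAdj t (i , _) (j , _) = not ⌊ i ≟ j ⌋

CompleteMultipartite : ∀ {k} (t : Fin k → ℕ) → Graph (Σ (Fin k) (λ i → Fin (t i)))
CompleteMultipartite t = record { adj = cmpAdj t ; adj-sym = s ; adj-irrefl = i }
  where
  s : ∀ x y → cmpAdj t x y ≡ cmpAdj t y x
  s (i , _) (j , _) with i ≟ j | j ≟ i
  ... | yes _ | yes _ = refl
  ... | no _ | no _ = refl
  ... | yes p | no q = ⊥-elim (q (sym p))
  ... | no p | yes q = ⊥-elim (p (sym q))
  i : ∀ x → cmpAdj t x x ≡ false
  i (j , _) with j ≟ j
  ... | yes _ = refl
  ... | no p = ⊥-elim (p refl)

module Submission where

-- Among any r neighbours of v two are adjacent (else K_{1,r}), so v lies
-- in a triangle. In a Z1-free graph, if one edge at a vertex lies in a triangle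
-- then every edge at it does, and this spreads along edges; by connectivity
-- every edge of G lies in a triangle. Then every vertex is equal or adjacent to
-- an endpoint of each edge (else Z1 appears near the edge), so non-adjacency is
-- transitive: "equal or non-adjacent" is an equivalence relation whose classes
-- are the parts of a complete multipartite structure. A part with r vertices
-- together with a vertex outside it would induce K_{1,r}.

open import Defs
open import Data.Nat using (ℕ; _≤_; _∸_)
open import Data.Fin using (Fin)
open import Data.Product using (Σ; _×_; ∃)

open import Data.Nat using (zero; suc; _+_; _≤?_; >-nonZero⁻¹)
open import Data.Nat.Properties using (≰⇒>; <⇒≤pred)
open import Data.Nat.ListAction using (sum)
open import Data.Fin using (zero; suc; _≟_; inject≤)
open import Data.Fin.Properties using (inject≤-injective; +↔⊎; all?; any?; nonZeroIndex)
open import Data.Bool using (Bool; true; false; not; if_then_else_)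
import Data.Bool as Bool
open import Data.Bool.Properties using (⇔→≡; ¬-not; not-¬; not-injective)
open import Data.List using (map; allFin; tabulate)
open import Data.List.Properties using (map-tabulate)
open import Data.Maybe using (Maybe; just; nothing)
import Data.Maybe as Maybe
open import Data.Maybe.Properties using (just-injective)
open import Data.Product using (_,_; proj₁; proj₂; map₂)
open import Data.Sum using (_⊎_; inj₁; inj₂)
open import Data.Sum.Function.Propositional using (_⊎-↔_)
open import Data.Empty using (⊥; ⊥-elim)
open import Relation.Nullary using (Dec; yes; no; contradiction)
open import Relation.Nullary.Decidable using (⌊_⌋; from-yes; _→-dec_)
open import Relation.Binary.PropositionalEquality
  using (_≡_; _≢_; refl; sym; trans; cong; cong₂; subst; module ≡-Reasoning)
open import Function using (_∘_; id; mk⇔)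
open import Function.Bundles using (_↔_; mk↔ₛ′; Inverse; Injection)
open import Function.Definitions using (Injective)
open import Function.Construct.Composition using (_↔-∘_)
open import Function.Properties.Inverse using (↔-sym; ↔⇒↣; ↔⇒⤖)
open import Axiom.UniquenessOfIdentityProofs using (module Decidable⇒UIP)

Sub : ∀ {n} → (Fin n → Bool) → Set
Sub {n} p = Σ (Fin n) λ x → p x ≡ true

Sub-≡ : ∀ {n} {p : Fin n → Bool} {x y : Fin n} {px : p x ≡ true} {py : p y ≡ true} →
        x ≡ y → _≡_ {A = Sub p} (x , px) (y , py)
Sub-≡ {px = px} {py} refl = cong (_ ,_) (Decidable⇒UIP.≡-irrelevant Bool._≟_ px py)

indicator : Bool → ℕ
indicator b = if b then 1 else 0

count : ∀ {n} → (Fin n → Bool) → ℕ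
count {zero}  p = 0
count {suc n} p = indicator (p zero) + count (p ∘ suc)

sum-indicator≡count : ∀ {n} (p : Fin n → Bool) → sum (map (indicator ∘ p) (allFin n)) ≡ count p
sum-indicator≡count {zero}  p = refl
sum-indicator≡count {suc n} p = cong (indicator (p zero) +_) (begin
  sum (map (indicator ∘ p) (tabulate suc))     ≡⟨ cong sum (map-tabulate suc (indicator ∘ p)) ⟩
  sum (tabulate (indicator ∘ p ∘ suc))         ≡⟨ cong sum (sym (map-tabulate id (indicator ∘ p ∘ suc))) ⟩
  sum (map (indicator ∘ p ∘ suc) (allFin n))   ≡⟨ sum-indicator≡count (p ∘ suc) ⟩
  count (p ∘ suc)                              ∎)
  where open ≡-Reasoning

deg≡count : ∀ {n} (G : FinGraph n) v → deg G v ≡ count (adj G v)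
deg≡count G v = sum-indicator≡count (adj G v)

true↔indicator : (b : Bool) → (b ≡ true) ↔ Fin (indicator b)
true↔indicator true  = mk↔ₛ′ (λ _ → zero) (λ _ → refl) (λ { zero → refl }) (λ { refl → refl })
true↔indicator false = mk↔ₛ′ (λ ()) (λ ()) (λ ()) (λ ())

Sub-split : ∀ {n} (p : Fin (suc n) → Bool) → Sub p ↔ ((p zero ≡ true) ⊎ Sub (p ∘ suc))
Sub-split p = mk↔ₛ′ split join split-join join-split
  where
  split : Sub p → (p zero ≡ true) ⊎ Sub (p ∘ suc)
  split (zero  , e) = inj₁ e
  split (suc x , e) = inj₂ (x , e)
  join : (p zero ≡ true) ⊎ Sub (p ∘ suc) → Sub p
  join (inj₁ e)       = zero , e
  join (inj₂ (x , e)) = suc x , e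
  split-join : ∀ s → split (join s) ≡ s
  split-join (inj₁ _) = refl
  split-join (inj₂ _) = refl
  join-split : ∀ s → join (split s) ≡ s
  join-split (zero  , _) = refl
  join-split (suc _ , _) = refl

Sub↔Fin : ∀ {n} (p : Fin n → Bool) → Sub p ↔ Fin (count p)
Sub↔Fin {zero}  p = mk↔ₛ′ (λ { (() , _) }) (λ ()) (λ ()) (λ { (() , _) })
Sub↔Fin {suc n} p = ↔-sym +↔⊎ ↔-∘ ((true↔indicator (p zero) ⊎-↔ Sub↔Fin (p ∘ suc)) ↔-∘ Sub-split p)

count-positive : ∀ {n} (p : Fin n → Bool) {x} → p x ≡ true → 1 ≤ count p
count-positive p {x} px = >-nonZero⁻¹ (count p) {{nonZeroIndex (Inverse.to (Sub↔Fin p) (x , px))}}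

distinct-witnesses : ∀ {n r} (p : Fin n → Bool) → r ≤ count p →
                     Σ (Fin r → Fin n) λ g → Injective _≡_ _≡_ g × (∀ j → p (g j) ≡ true)
distinct-witnesses p r≤count = proj₁ ∘ witness , injective , proj₂ ∘ witness
  where
  witness : Fin _ → Sub p
  witness j = Inverse.from (Sub↔Fin p) (inject≤ j r≤count)
  injective : Injective _≡_ _≡_ (proj₁ ∘ witness)
  injective {i} {j} eq = inject≤-injective r≤count r≤count i j
    (Injection.injective (↔⇒↣ (↔-sym (Sub↔Fin p))) (Sub-≡ eq))

true-or-false : (b : Bool) → b ≡ true ⊎ b ≡ false
true-or-false true  = inj₁ refl
true-or-false false = inj₂ refl

⌊⌋-complete : ∀ {A : Set} (d : Dec A) → A → ⌊ d ⌋ ≡ true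
⌊⌋-complete (yes _) _ = refl
⌊⌋-complete (no ¬a) a = ⊥-elim (¬a a)

⌊⌋-sound : ∀ {A : Set} (d : Dec A) → ⌊ d ⌋ ≡ true → A
⌊⌋-sound (yes a) _ = a

Σ-↔ : ∀ {I : Set} {A B : I → Set} → (∀ i → A i ↔ B i) → Σ I A ↔ Σ I B
Σ-↔ A↔B = mk↔ₛ′ (map₂ (Inverse.to (A↔B _))) (map₂ (Inverse.from (A↔B _)))
  (λ { (i , b) → cong (i ,_) (Inverse.strictlyInverseˡ (A↔B i) b) })
  (λ { (i , a) → cong (i ,_) (Inverse.strictlyInverseʳ (A↔B i) a) })

module Fibres {n k : ℕ} (f : Fin n → Fin k) where

  inFibre : Fin k → Fin n → Bool
  inFibre i x = ⌊ f x ≟ i ⌋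

  fibreSize : Fin k → ℕ
  fibreSize i = count (inFibre i)

  fibre-decomposition : Fin n ↔ Σ (Fin k) (Sub ∘ inFibre)
  fibre-decomposition = mk↔ₛ′ to from to-from (λ _ → refl)
    where
    to : Fin n → Σ (Fin k) (Sub ∘ inFibre)
    to x = f x , x , ⌊⌋-complete (f x ≟ f x) refl
    from : Σ (Fin k) (Sub ∘ inFibre) → Fin n
    from (_ , x , _) = x
    to-in-fibre : ∀ {i} x (fx≡i : f x ≡ i) (e : inFibre i x ≡ true) → to x ≡ (i , x , e)
    to-in-fibre x refl e = cong (f x ,_) (Sub-≡ refl)
    to-from : ∀ s → to (from s) ≡ s
    to-from (i , x , e) = to-in-fibre x (⌊⌋-sound (f x ≟ i) e) e

  partition : Fin n ↔ Σ (Fin k) (Fin ∘ fibreSize)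
  partition = Σ-↔ (Sub↔Fin ∘ inFibre) ↔-∘ fibre-decomposition

find : ∀ {m} → (Fin m → Bool) → Maybe (Fin m)
find {zero}  p = nothing
find {suc m} p = if p zero then just zero else Maybe.map suc (find (p ∘ suc))

find-cong : ∀ {m} {p q : Fin m → Bool} → (∀ x → p x ≡ q x) → find p ≡ find q
find-cong {zero}  p≗q = refl
find-cong {suc m} p≗q =
  cong₂ (λ b r → if b then just zero else Maybe.map suc r) (p≗q zero) (find-cong (p≗q ∘ suc))

find-sound : ∀ {m} (p : Fin m → Bool) {y} → find p ≡ just y → p y ≡ true
find-sound {suc m} p eq with p zero in p0 | find (p ∘ suc) in rest
find-sound {suc m} p refl | true  | _      = p0
find-sound {suc m} p refl | false | just y = find-sound (p ∘ suc) rest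

find-complete : ∀ {m} (p : Fin m → Bool) {x} → p x ≡ true → Σ (Fin m) λ y → find p ≡ just y
find-complete {suc m} p {zero} px with p zero
find-complete {suc m} p {zero} px  | true = zero , refl
find-complete {suc m} p {zero} () | false
find-complete {suc m} p {suc x} px with p zero | find-complete (p ∘ suc) px
... | true  | _      = zero , refl
... | false | y , eq rewrite eq = suc y , refl

-- The quotient of Fin n by a decidable equivalence relation R is some Fin k:
-- each class is represented by its least element, and the representatives are
-- enumerated by Sub↔Fin.
module Quotient {n : ℕ} (R : Fin n → Fin n → Bool)
  (R-refl  : ∀ x → R x x ≡ true)
  (R-sym   : ∀ {x y} → R x y ≡ true → R y x ≡ true)
  (R-trans : ∀ {x y z} → R x y ≡ true → R y z ≡ true → R x z ≡ true) where

  private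
    least : ∀ x → Σ (Fin n) λ y → find (R x) ≡ just y
    least x = find-complete (R x) (R-refl x)

  rep : Fin n → Fin n
  rep = proj₁ ∘ least

  rep-related : ∀ x → R x (rep x) ≡ true
  rep-related x = find-sound (R x) (proj₂ (least x))

  -- Related elements have the same class, hence the same least element.
  rep-resp : ∀ {x y} → R x y ≡ true → rep x ≡ rep y
  rep-resp {x} {y} xy = just-injective (begin
    just (rep x)  ≡⟨ sym (proj₂ (least x)) ⟩
    find (R x)    ≡⟨ find-cong same-class ⟩
    find (R y)    ≡⟨ proj₂ (least y) ⟩
    just (rep y)  ∎)
    where
    open ≡-Reasoning
    same-class : ∀ z → R x z ≡ R y z
    same-class z = ⇔→≡ (mk⇔ (R-trans (R-sym xy)) (R-trans xy))

  rep-reflects : ∀ {x y} → rep x ≡ rep y → R x y ≡ true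
  rep-reflects {x} {y} eq =
    R-trans (rep-related x) (R-sym (subst (λ w → R y w ≡ true) (sym eq) (rep-related y)))

  isRep : Fin n → Bool
  isRep y = ⌊ rep y ≟ y ⌋

  rep-isRep : ∀ x → isRep (rep x) ≡ true
  rep-isRep x = ⌊⌋-complete (rep (rep x) ≟ rep x) (sym (rep-resp (rep-related x)))

  classes : ℕ
  classes = count isRep

  class : Fin n → Fin classes
  class x = Inverse.to (Sub↔Fin isRep) (rep x , rep-isRep x)

  class-≡⇒R : ∀ {x y} → class x ≡ class y → R x y ≡ true
  class-≡⇒R eq = rep-reflects (cong proj₁ (Injection.injective (↔⇒↣ (Sub↔Fin isRep)) eq))

  R⇒class-≡ : ∀ {x y} → R x y ≡ true → class x ≡ class y
  R⇒class-≡ xy = cong (Inverse.to (Sub↔Fin isRep)) (Sub-≡ (rep-resp xy))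

  class-surjective : ∀ i → Σ (Fin n) λ y → class y ≡ i
  class-surjective i = y , (begin
    to (rep y , rep-isRep y)  ≡⟨ cong to (Sub-≡ (⌊⌋-sound (rep y ≟ y) y-isRep)) ⟩
    to (y , y-isRep)          ≡⟨ strictlyInverseˡ i ⟩
    i                         ∎)
    where
    open ≡-Reasoning
    open Inverse (Sub↔Fin isRep) using (to; from; strictlyInverseˡ)
    y : Fin n
    y = proj₁ (from i)
    y-isRep : isRep y ≡ true
    y-isRep = proj₂ (from i)

module Embeddings {n : ℕ} (G : FinGraph n) where

  private
    A : Fin n → Fin n → Bool
    A = adj G

  adj-sym′ : ∀ {x y b} → A x y ≡ b → A y x ≡ b
  adj-sym′ {x} {y} xy = trans (adj-sym G y x) xy

  Z1-twin-free : ∀ i j → (∀ k → z1Adj k i ≡ z1Adj k j) → i ≡ j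
  Z1-twin-free = from-yes (all? λ i → all? λ j →
                   (all? λ k → z1Adj k i Bool.≟ z1Adj k j) →-dec (i ≟ j))

  Z1-in : ∀ {c a b d} → A c a ≡ true → A c b ≡ true → A c d ≡ true → A a b ≡ true →
          A a d ≡ false → A b d ≡ false → HasInduced G Z1
  Z1-in {c} {a} {b} {d} ca cb cd ab ad bd = f , injective , preserves
    where
    f : Fin 4 → Fin n
    f zero                   = c
    f (suc zero)             = a
    f (suc (suc zero))       = b
    f (suc (suc (suc zero))) = d
    preserves : ∀ x y → A (f x) (f y) ≡ z1Adj x y
    preserves zero zero = adj-irrefl G c
    preserves zero (suc zero) = ca
    preserves zero (suc (suc zero)) = cb
    preserves zero (suc (suc (suc zero))) = cd
    preserves (suc zero) zero = adj-sym′ ca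
    preserves (suc zero) (suc zero) = adj-irrefl G a
    preserves (suc zero) (suc (suc zero)) = ab
    preserves (suc zero) (suc (suc (suc zero))) = ad
    preserves (suc (suc zero)) zero = adj-sym′ cb
    preserves (suc (suc zero)) (suc zero) = adj-sym′ ab
    preserves (suc (suc zero)) (suc (suc zero)) = adj-irrefl G b
    preserves (suc (suc zero)) (suc (suc (suc zero))) = bd
    preserves (suc (suc (suc zero))) zero = adj-sym′ cd
    preserves (suc (suc (suc zero))) (suc zero) = adj-sym′ ad
    preserves (suc (suc (suc zero))) (suc (suc zero)) = adj-sym′ bd
    preserves (suc (suc (suc zero))) (suc (suc (suc zero))) = adj-irrefl G d
    -- Equal images would have equal neighbourhoods in Z1.
    injective : Injective _≡_ _≡_ f
    injective {i} {j} fi≡fj = Z1-twin-free i j λ k → begin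
      z1Adj k i      ≡⟨ sym (preserves k i) ⟩
      A (f k) (f i)  ≡⟨ cong (A (f k)) fi≡fj ⟩
      A (f k) (f j)  ≡⟨ preserves k j ⟩
      z1Adj k j      ∎
      where open ≡-Reasoning

  star-in : ∀ {r} v (g : Fin r → Fin n) → Injective _≡_ _≡_ g → (∀ j → A v (g j) ≡ true) →
            (∀ i j → A (g i) (g j) ≡ false) → HasInduced G (K1 r)
  star-in {r} v g g-injective vg independent = f , injective , preserves
    where
    f : Fin (suc r) → Fin n
    f zero    = v
    f (suc j) = g j
    preserves : ∀ x y → A (f x) (f y) ≡ starAdj r x y
    preserves zero    zero    = adj-irrefl G v
    preserves zero    (suc j) = vg j
    preserves (suc i) zero    = adj-sym′ (vg i)
    preserves (suc i) (suc j) = independent i j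
    leaf≢centre : ∀ j → g j ≢ v
    leaf≢centre j gj≡v = contradiction (trans (sym (subst (λ w → A v w ≡ true) gj≡v (vg j)))
                                              (adj-irrefl G v)) λ ()
    injective : Injective _≡_ _≡_ f
    injective {zero}  {zero}  _  = refl
    injective {zero}  {suc j} eq = ⊥-elim (leaf≢centre j (sym eq))
    injective {suc i} {zero}  eq = ⊥-elim (leaf≢centre i eq)
    injective {suc i} {suc j} eq = cong suc (g-injective eq)

  -- In a K_{1,r}-free graph a vertex of degree at least r lies in a triangle:
  -- some two of any r of its neighbours are adjacent.
  high-degree-triangle : ∀ {r} → Free G (K1 r) → ∀ v → r ≤ deg G v →
                         Σ (Fin n) λ a → Σ (Fin n) λ b → A v a ≡ true × A v b ≡ true × A a b ≡ true
  high-degree-triangle {r} K1r-free v r≤deg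
    with distinct-witnesses (A v) (subst (r ≤_) (deg≡count G v) r≤deg)
  ... | g , g-injective , vg
    with any? (λ i → any? λ j → A (g i) (g j) Bool.≟ true)
  ...   | yes (i , j , gij) = g i , g j , vg i , vg j , gij
  ...   | no no-edge = ⊥-elim (K1r-free (star-in v g g-injective vg
                         λ i j → ¬-not λ gij → no-edge (i , j , gij)))

module Z1Free {n : ℕ} (G : FinGraph n) (Z1-free : Free G Z1) where

  open Embeddings G

  private
    A : Fin n → Fin n → Bool
    A = adj G

  no-Z1 : ∀ {c a b d} → A c a ≡ true → A c b ≡ true → A c d ≡ true → A a b ≡ true →
          A a d ≡ false → A b d ≡ false → ⊥
  no-Z1 ca cb cd ab ad bd = Z1-free (Z1-in ca cb cd ab ad bd)

  CommonNeighbour : Fin n → Fin n → Set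
  CommonNeighbour x y = Σ (Fin n) λ c → A x c ≡ true × A y c ≡ true

  EdgesInTriangles : Fin n → Set
  EdgesInTriangles y = ∀ z → A y z ≡ true → CommonNeighbour y z

  -- If one edge yx at y lies in a triangle yxc, then so does every edge yz:
  -- otherwise y, x, c, z would induce Z1.
  triangle-at : ∀ {y x c} → A y x ≡ true → A y c ≡ true → A x c ≡ true → EdgesInTriangles y
  triangle-at {y} {x} {c} yx yc xc z yz with true-or-false (A z x) | true-or-false (A z c)
  ... | inj₁ zx | _       = x , yx , zx
  ... | inj₂ zx | inj₁ zc = c , yc , zc
  ... | inj₂ zx | inj₂ zc = ⊥-elim (no-Z1 yx yc yz xc (adj-sym′ zx) (adj-sym′ zc))

  triangles-spread : ∀ {y z} → EdgesInTriangles y → A y z ≡ true → EdgesInTriangles z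
  triangles-spread triangles-y yz with triangles-y _ yz
  ... | c , yc , zc = triangle-at (adj-sym′ yz) zc yc

  triangles-along : ∀ {x y} → EdgesInTriangles x → Walk G x y → EdgesInTriangles y
  triangles-along triangles-x here          = triangles-x
  triangles-along triangles-x (step xy walk) = triangles-along (triangles-spread triangles-x xy) walk

  module AllEdgesInTriangles (all-triangles : ∀ y → EdgesInTriangles y) where

    -- For every edge xz, a vertex w adjacent to a neighbour u of x is adjacent
    -- to x or z: otherwise four of x, z, u, w and a common neighbour c of u and
    -- x induce Z1.
    near-edge : ∀ {x z u w} → A x z ≡ true → A u x ≡ true → A w u ≡ true →
                A w x ≡ false → A w z ≡ false → ⊥
    near-edge {x} {z} {u} {w} xz ux wu wx wz with true-or-false (A u z)
    ... | inj₁ uz = no-Z1 ux uz (adj-sym′ wu) xz (adj-sym′ wx) (adj-sym′ wz)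
    ... | inj₂ uz with all-triangles u x ux
    ...   | c , uc , xc with true-or-false (A c w) | true-or-false (A c z)
    ...     | inj₂ cw | _       = no-Z1 ux uc (adj-sym′ wu) xc (adj-sym′ wx) cw
    ...     | inj₁ cw | inj₂ cz = no-Z1 (adj-sym′ ux) xc xz uc uz cz
    ...     | inj₁ cw | inj₁ cz = no-Z1 cw (adj-sym′ uc) cz wu wz uz

    Dominates : Fin n → Fin n → Fin n → Set
    Dominates w x z = (w ≡ x) ⊎ (A w x ≡ true) ⊎ (A w z ≡ true)

    dominates : ∀ {x z w} → A x z ≡ true → Walk G w x → Dominates w x z
    dominates xz here = inj₁ refl
    dominates {x} {z} {w} xz (step ww′ walk) with true-or-false (A w x) | true-or-false (A w z)
    ... | inj₁ wx | _       = inj₂ (inj₁ wx)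
    ... | inj₂ wx | inj₁ wz = inj₂ (inj₂ wz)
    ... | inj₂ wx | inj₂ wz with dominates xz walk
    ...   | inj₁ refl        = contradiction (trans (sym ww′) wx) λ ()
    ...   | inj₂ (inj₁ w′x) = ⊥-elim (near-edge xz w′x ww′ wx wz)
    ...   | inj₂ (inj₂ w′z) = ⊥-elim (near-edge (adj-sym′ xz) w′z ww′ wz wx)

    -- Consequently non-adjacency is transitive: if x and z were adjacent,
    -- y would have to be adjacent to one of them.
    nonadjacency-transitive : Connected G → ∀ {x y z} → A x y ≡ false → A y z ≡ false → A x z ≡ false
    nonadjacency-transitive connected {x} {y} {z} xy yz with true-or-false (A x z)
    ... | inj₂ xz = xz
    ... | inj₁ xz with dominates xz (connected y x)
    ...   | inj₁ refl        = yz
    ...   | inj₂ (inj₁ yx)  = contradiction (trans (sym (adj-sym′ yx)) xy) λ ()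
    ...   | inj₂ (inj₂ yz′) = contradiction (trans (sym yz′) yz) λ ()

-- A graph in which non-adjacency is transitive is complete multipartite: its
-- parts are the classes of the equivalence relation "equal or non-adjacent".
module Multipartite {n : ℕ} (G : FinGraph n)
  (nonadjacency-transitive : ∀ {x y z} → adj G x y ≡ false → adj G y z ≡ false → adj G x z ≡ false)
  where

  open Embeddings G

  private
    A : Fin n → Fin n → Bool
    A = adj G

  NonAdjacent : Fin n → Fin n → Bool
  NonAdjacent x y = not (A x y)

  open Quotient NonAdjacent
    (cong not ∘ adj-irrefl G)
    (cong not ∘ adj-sym′ ∘ not-injective)
    (λ xy yz → cong not (nonadjacency-transitive (not-injective xy) (not-injective yz)))
    public using (classes; class; class-≡⇒R; R⇒class-≡; class-surjective)
  open Fibres class using (inFibre; fibreSize; partition)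

  parts : Fin classes → ℕ
  parts = fibreSize

  adjacency : ∀ x y → not ⌊ class x ≟ class y ⌋ ≡ A x y
  adjacency x y with class x ≟ class y
  ... | yes same = sym (not-injective (class-≡⇒R same))
  ... | no  diff = sym (¬-not λ nonadjacent → diff (R⇒class-≡ (cong not nonadjacent)))

  isomorphism : G ≅ CompleteMultipartite parts
  isomorphism = ↔⇒⤖ partition , adjacency

  part-nonempty : ∀ i → 1 ≤ parts i
  part-nonempty i with class-surjective i
  ... | y , refl = count-positive (inFibre i) (⌊⌋-complete (class y ≟ class y) refl)

  -- If G is K_{1,r}-free and has an edge, every part has fewer than r
  -- vertices: r vertices of one part, together with an endpoint of the edge
  -- outside that part, would induce K_{1,r}.
  part-small : ∀ {r} → Free G (K1 r) → ∀ {v u} → A v u ≡ true → ∀ i → parts i ≤ r ∸ 1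
  part-small {r} K1r-free {v} {u} vu i with r ≤? parts i
  ... | no  r≰part = <⇒≤pred (≰⇒> r≰part)
  ... | yes r≤part with distinct-witnesses (inFibre i) r≤part
  ...   | g , g-injective , g-in-part =
    ⊥-elim (K1r-free (star-in centre g g-injective centre-adjacent independent))
    where
    in-part : ∀ a → class (g a) ≡ i
    in-part a = ⌊⌋-sound (class (g a) ≟ i) (g-in-part a)
    independent : ∀ a b → A (g a) (g b) ≡ false
    independent a b = not-injective (class-≡⇒R (trans (in-part a) (sym (in-part b))))
    outside : Σ (Fin n) λ c → class c ≢ i
    outside with class v ≟ i
    ... | no  v∉i = v , v∉i
    ... | yes v∈i = u , λ u∈i →
      contradiction (class-≡⇒R (trans v∈i (sym u∈i))) (not-¬ (cong not vu))
    centre : Fin n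
    centre = proj₁ outside
    centre-adjacent : ∀ a → A centre (g a) ≡ true
    centre-adjacent a = ¬-not λ nonadjacent →
      proj₂ outside (trans (R⇒class-≡ (cong not nonadjacent)) (in-part a))

corollary1 : (r : ℕ) → 3 ≤ r → (n : ℕ) → (G : FinGraph n) → Connected G → Free G Z1 → Free G (K1 r) → (∃ λ v → r ≤ deg G v) → Σ ℕ λ k → Σ (Fin k → ℕ) λ t → ((i : Fin k) → 1 ≤ t i × t i ≤ r ∸ 1) × (G ≅ CompleteMultipartite t)
corollary1 r _ n G connected Z1-free K1r-free (v , r≤deg)
  with Embeddings.high-degree-triangle G K1r-free v r≤deg
... | a , b , va , vb , ab =
  classes , parts , (λ i → part-nonempty i , part-small K1r-free va i) , isomorphism
  where
  open Z1Free G Z1-free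

  all-triangles : ∀ y → EdgesInTriangles y
  all-triangles y = triangles-along (triangle-at va vb ab) (connected v y)

  open AllEdgesInTriangles all-triangles using (nonadjacency-transitive)
  open Multipartite G (nonadjacency-transitive connected)
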